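{- Let $\Gamma=(K_{1,m},\sigma,\mu)$ be a signed star with vertices $v_1,\dots,v_{m+1}$, where $d(v_1)=m$, and let $\mu$ be the canonical marking $\mu^c$ or the plurality marking $\mu^p$. Then (i) $\Sigma_{A(\Gamma)}(X)=\dfrac{(m+1)X+2m\mu(v_1)}{X^2-m}$; (ii) $\Sigma_{L(\Gamma)}(X)=\dfrac{(m+1)X-(m^2+1)-2m\mu(v_1)}{X\big(X-(m+1)\big)}$; (iii) $\Sigma_{Q(\Gamma)}(X)=\dfrac{(m+1)X-(m^2+1)+2m\mu(v_1)}{X(X-m-1)}$.
   Context: A signed graph $\Gamma=(G,\sigma,\mu)$ has a finite simple graph $G$ with vertices $v_1,\dots,v_n$, signature $\sigma:E(G)\to\{\pm1\}$ and marking $\mu:V(G)\to\{\pm1\}$; $\mu(\Gamma)=(\mu(v_1),\dots,\mu(v_n))^T$. $A(\Gamma)$ has $(i,j)$ entry $\sigma(v_iv_j)$ if $v_i\sim v_j$ and $0$ otherwise; $D(\Gamma)$ is the diagonal matrix of (unsigned) degrees; $L=D-A$, $Q=D+A$. The signed $N$-coronal is the rational function $\Sigma_N(X)=\mu(\Gamma)^T(XI_n-N)^{ -1}\mu(\Gamma)$. Canonical marking: $\mu^c(w)=\prod_{e\ni w}\sigma(e)$. Plurality marking: $\mu^p(w)=-1$ if $w$ has more negative than positive incident edges, $+1$ otherwise. -}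

module Defs where

open import Data.Nat using (ℕ; zero; suc)
open import Data.Bool using (Bool; true; false; if_then_else_; _∨_; _∧_; not)
open import Data.Fin using (Fin; zero; suc)
open import Data.Integer using (+_)
open import Data.Rational using (ℚ; _+_; _*_; _-_; -_; 0ℚ; 1ℚ; _/_)
open import Data.Nat using (_<ᵇ_)
open import Relation.Binary.PropositionalEquality using (_≡_; refl)
open import Relation.Nullary.Decidable using (⌊_⌋)
open import Data.Fin using (_≟_)
open import Data.Product using (_×_)

ℕ→ℚ : ℕ → ℚ
ℕ→ℚ n = (+ n) / 1

ΣF : ∀ {n} → (Fin n → ℚ) → ℚ
ΣF {zero}  f = 0ℚ
ΣF {suc n} f = f zero + ΣF (λ i → f (suc i))

countF : ∀ {n} → (Fin n → Bool) → ℕ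
countF {zero}  p = zero
countF {suc n} p = (if p zero then 1 else 0) Data.Nat.+ countF (λ i → p (suc i))

data Sign : Set where
  pos neg : Sign

_·s_ : Sign → Sign → Sign
pos ·s s = s
neg ·s pos = neg
neg ·s neg = pos

isNeg : Sign → Bool
isNeg pos = false
isNeg neg = true

Sign→ℚ : Sign → ℚ
Sign→ℚ pos = 1ℚ
Sign→ℚ neg = - 1ℚ

prodSign : ∀ {n} → (Fin n → Bool) → (Fin n → Sign) → Sign
prodSign {zero}  p s = pos
prodSign {suc n} p s =
  (if p zero then s zero else pos) ·s prodSign (λ i → p (suc i)) (λ i → s (suc i))

-- Signed graph on vertices Fin n: finite simple graph (symmetric, irreflexive
-- adjacency) with a signature σ on edges (σ given on all ordered pairs, symmetric;
-- only its values on edges matter).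
record SignedGraph (n : ℕ) : Set where
  field
    adj    : Fin n → Fin n → Bool
    adj-sym    : ∀ i j → adj i j ≡ adj j i
    adj-irrefl : ∀ i → adj i i ≡ false
    σ      : Fin n → Fin n → Sign
    σ-sym  : ∀ i j → σ i j ≡ σ j i

Matrix : ℕ → Set
Matrix n = Fin n → Fin n → ℚ

Vector : ℕ → Set
Vector n = Fin n → ℚ

module _ {n : ℕ} (Γ : SignedGraph n) where
  open SignedGraph Γ

  deg : Fin n → ℕ
  deg i = countF (adj i)

  Adj : Matrix n
  Adj i j = if adj i j then Sign→ℚ (σ i j) else 0ℚ

  Deg : Matrix n
  Deg i j = if ⌊ i ≟ j ⌋ then ℕ→ℚ (deg i) else 0ℚ

  Lap : Matrix n
  Lap i j = Deg i j - Adj i j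

  SLap : Matrix n
  SLap i j = Deg i j + Adj i j

  canonicalMarking : Fin n → Sign
  canonicalMarking w = prodSign (adj w) (σ w)

  pluralityMarking : Fin n → Sign
  pluralityMarking w =
    if countF (λ j → adj w j ∧ not (isNeg (σ w j))) <ᵇ countF (λ j → adj w j ∧ isNeg (σ w j))
    then neg else pos

Id : ∀ {n} → Matrix n
Id i j = if ⌊ i ≟ j ⌋ then 1ℚ else 0ℚ

shift : ∀ {n} → ℚ → Matrix n → Matrix n
shift X N i j = X * Id i j - N i j

_⊗_ : ∀ {n} → Matrix n → Matrix n → Matrix n
(M ⊗ N) i j = ΣF (λ k → M i k * N k j)

IsInverse : ∀ {n} → Matrix n → Matrix n → Set
IsInverse M B = (∀ i j → (M ⊗ B) i j ≡ Id i j) × (∀ i j → (B ⊗ M) i j ≡ Id i j)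

-- μᵀ B μ for a marking μ (so with B = (XI - N)⁻¹ this is the N-coronal Σ_N(X))
coronalValue : ∀ {n} → (Fin n → Sign) → Matrix n → ℚ
coronalValue μ B = ΣF (λ i → ΣF (λ j → Sign→ℚ (μ i) * B i j * Sign→ℚ (μ j)))

-- The signed star K_{1,m} on vertices Fin (suc m); vertex zero (= v₁) is the
-- centre, vertex (suc j) is a leaf; the edge v₁ — suc j has sign s j.
starAdj : ∀ {m} → Fin (suc m) → Fin (suc m) → Bool
starAdj zero    zero    = false
starAdj zero    (suc j) = true
starAdj (suc i) zero    = true
starAdj (suc i) (suc j) = false

starσ : ∀ {m} → (Fin m → Sign) → Fin (suc m) → Fin (suc m) → Sign
starσ s zero    (suc j) = s j
starσ s (suc i) zero    = s i
starσ s _       _       = pos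

star : (m : ℕ) → (Fin m → Sign) → SignedGraph (suc m)
star m s = record
  { adj = starAdj
  ; adj-sym = sym'
  ; adj-irrefl = irr
  ; σ = starσ s
  ; σ-sym = σsym
  }
  where
  sym' : ∀ i j → starAdj i j ≡ starAdj j i
  sym' zero zero = refl
  sym' zero (suc j) = refl
  sym' (suc i) zero = refl
  sym' (suc i) (suc j) = refl
  irr : ∀ i → starAdj {m} i i ≡ false
  irr zero = refl
  irr (suc i) = refl
  σsym : ∀ i j → starσ s i j ≡ starσ s j i
  σsym zero zero = refl
  σsym zero (suc j) = refl
  σsym (suc i) zero = refl
  σsym (suc i) (suc j) = refl

data MarkingKind : Set where
  canonical plurality : MarkingKind

markingOf : ∀ {n} → MarkingKind → SignedGraph n → Fin n → Sign
markingOf canonical  Γ = canonicalMarking Γ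
markingOf plurality  Γ = pluralityMarking Γ

-- Every matrix αI + βD + γA of the signed star with edge signs σⱼ has the same shape:
-- an entry p at the centre, ε σⱼ on the spokes and δ I on the leaf block. A leaf has a
-- single incident edge, so both markings give it the sign of that edge and μ = (e, σ).
-- The system N y = c μ then stays inside vectors of the form (a, σ b) and is solved by
-- a = δ e − m ε, b = p − ε e with c = p δ − m ε², whence
-- c · μᵀ N⁻¹ μ = μᵀ y = e a + m b = δ + m p − 2 m ε e.  If c = 0, then (−δ, σ ε) would be
-- a nonzero kernel vector of N, so c ≠ 0 whenever N is invertible and ε ≠ 0.

module Submission where

open import Defs
open import Data.Nat using (ℕ; suc; _≤_)
open import Data.Fin using (Fin; zero)
open import Data.Integer using (+_)
open import Data.Rational using (ℚ; _+_; _*_; _-_; 0ℚ)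
open import Data.Product using (_×_)
open import Relation.Binary.PropositionalEquality using (_≡_; _≢_)

open import Algebra.Bundles using (CommutativeRing)
open import Data.Nat using (zero)
open import Data.Fin using (suc; fromℕ<) renaming (_≟_ to _≟ᶠ_)
open import Data.Bool using (true; false; if_then_else_)
open import Data.Integer as ℤ using ()
import Data.Integer.Properties as ℤ
import Data.Nat.Coprimality as Coprime
open import Data.Rational using (1ℚ; -_; _/_)
open import Data.Rational.Properties
  using (+-*-commutativeRing; _≟_; normalize-coprime; /-cong; +-comm; +-identityˡ; +-identityʳ; *-assoc; *-distribʳ-+; *-identityˡ; *-identityʳ; *-zeroˡ; *-zeroʳ)
open import Data.Product using (_,_)
open import Function using (_∘_)
open import Relation.Binary.PropositionalEquality using (refl; sym; trans; cong; cong₂; module ≡-Reasoning)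
open import Relation.Nullary.Decidable using (⌊_⌋; yes; no; dec⇒maybe)
open import Tactic.RingSolver using (solve-∀)
open import Tactic.RingSolver.Core.AlmostCommutativeRing using (AlmostCommutativeRing; fromCommutativeRing)

open import Algebra.Properties.Semiring.Sum (CommutativeRing.semiring +-*-commutativeRing)
  using (sum; ∑-comm; *-distribˡ-sum; *-distribʳ-sum)

ℚ-ring : AlmostCommutativeRing _ _
ℚ-ring = fromCommutativeRing +-*-commutativeRing (λ x → dec⇒maybe (0ℚ ≟ x))

ΣF≡sum : ∀ {n} (f : Vector n) → ΣF f ≡ sum f
ΣF≡sum {zero}  f = refl
ΣF≡sum {suc n} f = cong (λ t → f zero + t) (ΣF≡sum (f ∘ suc))

ΣF-cong : ∀ {n} {f g : Vector n} → (∀ i → f i ≡ g i) → ΣF f ≡ ΣF g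
ΣF-cong {zero}  f≗g = refl
ΣF-cong {suc n} f≗g = cong₂ _+_ (f≗g zero) (ΣF-cong (f≗g ∘ suc))

*-distribˡ-ΣF : ∀ {n} c (f : Vector n) → c * ΣF f ≡ ΣF (λ i → c * f i)
*-distribˡ-ΣF c f = trans (cong (c *_) (ΣF≡sum f)) (trans (*-distribˡ-sum c f) (sym (ΣF≡sum (λ i → c * f i))))

*-distribʳ-ΣF : ∀ {n} c (f : Vector n) → ΣF f * c ≡ ΣF (λ i → f i * c)
*-distribʳ-ΣF c f = trans (cong (_* c) (ΣF≡sum f)) (trans (*-distribʳ-sum c f) (sym (ΣF≡sum (λ i → f i * c))))

ΣF-comm : ∀ {m n} (f : Fin m → Fin n → ℚ) →
  ΣF (λ i → ΣF (f i)) ≡ ΣF (λ j → ΣF (λ i → f i j))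
ΣF-comm f = begin
  ΣF (λ i → ΣF (f i))               ≡⟨ ΣF-cong (λ i → ΣF≡sum (f i)) ⟩
  ΣF (λ i → sum (f i))              ≡⟨ ΣF≡sum (λ i → sum (f i)) ⟩
  sum (λ i → sum (f i))             ≡⟨ ∑-comm f ⟩
  sum (λ j → sum (λ i → f i j))     ≡⟨ ΣF≡sum (λ j → sum (λ i → f i j)) ⟨
  ΣF (λ j → sum (λ i → f i j))      ≡⟨ ΣF-cong (λ j → ΣF≡sum (λ i → f i j)) ⟨
  ΣF (λ j → ΣF (λ i → f i j))       ∎
  where open ≡-Reasoning

ℕ→ℚ-suc : ∀ n → ℕ→ℚ (suc n) ≡ ℕ→ℚ n + 1ℚ
-- ℕ→ℚ n is already in lowest terms, so rewriting it as mkℚ (+ n) 0 _ makes the sum compute.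
ℕ→ℚ-suc n = begin
  + suc n / 1                       ≡⟨ /-cong (ℤ.+-comm (+ 1) (+ n)) refl ⟩
  (+ n ℤ.+ + 1) / 1                 ≡⟨ /-cong (cong₂ ℤ._+_ (ℤ.*-identityʳ (+ n)) refl) refl ⟨
  (+ n ℤ.* + 1 ℤ.+ + 1 ℤ.* + 1) / 1 ≡⟨ cong (_+ 1ℚ) (normalize-coprime (Coprime.sym (Coprime.1-coprimeTo n))) ⟨
  ℕ→ℚ n + 1ℚ                        ∎
  where open ≡-Reasoning

ΣF-const : ∀ n c → ΣF {n} (λ _ → c) ≡ ℕ→ℚ n * c
ΣF-const zero    c = sym (*-zeroˡ c)
ΣF-const (suc n) c = begin
  c + ΣF {n} (λ _ → c)              ≡⟨ cong (λ t → c + t) (ΣF-const n c) ⟩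
  c + ℕ→ℚ n * c                     ≡⟨ +-comm c _ ⟩
  ℕ→ℚ n * c + c                     ≡⟨ cong (λ t → ℕ→ℚ n * c + t) (*-identityˡ c) ⟨
  ℕ→ℚ n * c + 1ℚ * c                ≡⟨ *-distribʳ-+ c (ℕ→ℚ n) 1ℚ ⟨
  (ℕ→ℚ n + 1ℚ) * c                  ≡⟨ cong (_* c) (ℕ→ℚ-suc n) ⟨
  ℕ→ℚ (suc n) * c                   ∎
  where open ≡-Reasoning

Id-suc : ∀ {n} (i k : Fin n) → Id (suc i) (suc k) ≡ Id i k
Id-suc i k with i ≟ᶠ k
... | yes _ = refl
... | no _  = refl

infixr 7 _*ᵥ_

_*ᵥ_ : ∀ {n} → Matrix n → Vector n → Vector n
(N *ᵥ y) i = ΣF (λ k → N i k * y k)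

*ᵥ-cong : ∀ {n} (N : Matrix n) {y z : Vector n} → (∀ k → y k ≡ z k) → ∀ i → (N *ᵥ y) i ≡ (N *ᵥ z) i
*ᵥ-cong N y≗z i = ΣF-cong (λ k → cong (N i k *_) (y≗z k))

*ᵥ-zero : ∀ {n} (N : Matrix n) i → (N *ᵥ (λ _ → 0ℚ)) i ≡ 0ℚ
*ᵥ-zero N i = trans (sym (*-distribʳ-ΣF 0ℚ (N i))) (*-zeroʳ (ΣF (N i)))

Id-*ᵥ : ∀ {n} (y : Vector n) i → (Id *ᵥ y) i ≡ y i
Id-*ᵥ {suc n} y zero = begin
  1ℚ * y zero + ΣF (λ k → 0ℚ * y (suc k))  ≡⟨ cong₂ _+_ (*-identityˡ (y zero)) (sym (*-distribˡ-ΣF 0ℚ (y ∘ suc))) ⟩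
  y zero + 0ℚ * ΣF (y ∘ suc)               ≡⟨ cong (λ t → y zero + t) (*-zeroˡ (ΣF (y ∘ suc))) ⟩
  y zero + 0ℚ                              ≡⟨ +-identityʳ (y zero) ⟩
  y zero                                   ∎
  where open ≡-Reasoning
Id-*ᵥ {suc n} y (suc i) = begin
  0ℚ * y zero + ΣF (λ k → Id (suc i) (suc k) * y (suc k))
    ≡⟨ cong₂ _+_ (*-zeroˡ (y zero)) (ΣF-cong (λ k → cong (_* y (suc k)) (Id-suc i k))) ⟩
  0ℚ + (Id *ᵥ (y ∘ suc)) i
    ≡⟨ +-identityˡ _ ⟩
  (Id *ᵥ (y ∘ suc)) i
    ≡⟨ Id-*ᵥ (y ∘ suc) i ⟩
  y (suc i)
    ∎
  where open ≡-Reasoning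

⊗-*ᵥ : ∀ {n} (M N : Matrix n) (y : Vector n) i → ((M ⊗ N) *ᵥ y) i ≡ (M *ᵥ N *ᵥ y) i
⊗-*ᵥ M N y i = begin
  ΣF (λ k → ΣF (λ j → M i j * N j k) * y k)    ≡⟨ ΣF-cong (λ k → *-distribʳ-ΣF (y k) (λ j → M i j * N j k)) ⟩
  ΣF (λ k → ΣF (λ j → M i j * N j k * y k))    ≡⟨ ΣF-comm (λ k j → M i j * N j k * y k) ⟩
  ΣF (λ j → ΣF (λ k → M i j * N j k * y k))    ≡⟨ ΣF-cong (λ j → ΣF-cong (λ k → *-assoc (M i j) (N j k) (y k))) ⟩
  ΣF (λ j → ΣF (λ k → M i j * (N j k * y k)))  ≡⟨ ΣF-cong (λ j → *-distribˡ-ΣF (M i j) (λ k → N j k * y k)) ⟨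
  ΣF (λ j → M i j * (N *ᵥ y) j)                ∎
  where open ≡-Reasoning

IsLeftInverse : ∀ {n} → Matrix n → Matrix n → Set
IsLeftInverse N B = ∀ i j → (B ⊗ N) i j ≡ Id i j

leftInverse-*ᵥ : ∀ {n} {N B : Matrix n} → IsLeftInverse N B →
  ∀ y i → (B *ᵥ N *ᵥ y) i ≡ y i
leftInverse-*ᵥ {N = N} {B} B⊗N≡Id y i = begin
  (B *ᵥ N *ᵥ y) i     ≡⟨ ⊗-*ᵥ B N y i ⟨
  ((B ⊗ N) *ᵥ y) i    ≡⟨ ΣF-cong (λ k → cong (_* y k) (B⊗N≡Id i k)) ⟩
  (Id *ᵥ y) i         ≡⟨ Id-*ᵥ y i ⟩
  y i                 ∎
  where open ≡-Reasoning

leftInverse-kernel : ∀ {n} {N B : Matrix n} → IsLeftInverse N B →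
  ∀ v → (∀ i → (N *ᵥ v) i ≡ 0ℚ) → ∀ i → v i ≡ 0ℚ
leftInverse-kernel {N = N} {B} B⊗N≡Id v Nv≡0 i = begin
  v i                      ≡⟨ leftInverse-*ᵥ {N = N} {B} B⊗N≡Id v i ⟨
  (B *ᵥ N *ᵥ v) i          ≡⟨ *ᵥ-cong B Nv≡0 i ⟩
  (B *ᵥ (λ _ → 0ℚ)) i      ≡⟨ *ᵥ-zero B i ⟩
  0ℚ                       ∎
  where open ≡-Reasoning

coronalValue-*ʳ : ∀ {n} (μ : Fin n → Sign) (B : Matrix n) c →
  coronalValue μ B * c ≡ ΣF (λ i → Sign→ℚ (μ i) * (B *ᵥ (λ j → c * Sign→ℚ (μ j))) i)
coronalValue-*ʳ μ B c = begin
  ΣF (λ i → ΣF (λ j → μ̂ i * B i j * μ̂ j)) * c      ≡⟨ *-distribʳ-ΣF c (λ i → ΣF (λ j → μ̂ i * B i j * μ̂ j)) ⟩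
  ΣF (λ i → ΣF (λ j → μ̂ i * B i j * μ̂ j) * c)      ≡⟨ ΣF-cong (λ i → *-distribʳ-ΣF c (λ j → μ̂ i * B i j * μ̂ j)) ⟩
  ΣF (λ i → ΣF (λ j → μ̂ i * B i j * μ̂ j * c))      ≡⟨ ΣF-cong (λ i → ΣF-cong (λ j → rearrange (μ̂ i) (B i j) (μ̂ j) c)) ⟩
  ΣF (λ i → ΣF (λ j → μ̂ i * (B i j * (c * μ̂ j))))  ≡⟨ ΣF-cong (λ i → *-distribˡ-ΣF (μ̂ i) (λ j → B i j * (c * μ̂ j))) ⟨
  ΣF (λ i → μ̂ i * (B *ᵥ (λ j → c * μ̂ j)) i)         ∎
  where
  open ≡-Reasoning
  μ̂ = Sign→ℚ ∘ μ
  rearrange : ∀ a b d c → a * b * d * c ≡ a * (b * (c * d))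
  rearrange = solve-∀ ℚ-ring

leftInverse-coronalValue : ∀ {n} {N B : Matrix n} → IsLeftInverse N B →
  ∀ (μ : Fin n → Sign) c y → (∀ i → (N *ᵥ y) i ≡ c * Sign→ℚ (μ i)) →
  coronalValue μ B * c ≡ ΣF (λ i → Sign→ℚ (μ i) * y i)
leftInverse-coronalValue {N = N} {B} B⊗N≡Id μ c y Ny≡cμ =
  trans (coronalValue-*ʳ μ B c)
        (ΣF-cong (λ i → cong (Sign→ℚ (μ i) *_)
          (trans (sym (*ᵥ-cong B Ny≡cμ i)) (leftInverse-*ᵥ {N = N} {B} B⊗N≡Id y i))))

Sign→ℚ-square : ∀ t → Sign→ℚ t * Sign→ℚ t ≡ 1ℚ
Sign→ℚ-square pos = refl
Sign→ℚ-square neg = refl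

Sign→ℚ-involutive : ∀ t x → Sign→ℚ t * (Sign→ℚ t * x) ≡ x
Sign→ℚ-involutive t x = begin
  Sign→ℚ t * (Sign→ℚ t * x)  ≡⟨ *-assoc (Sign→ℚ t) (Sign→ℚ t) x ⟨
  Sign→ℚ t * Sign→ℚ t * x    ≡⟨ cong (_* x) (Sign→ℚ-square t) ⟩
  1ℚ * x                     ≡⟨ *-identityˡ x ⟩
  x                          ∎
  where open ≡-Reasoning

countF-false : ∀ n → countF {n} (λ _ → false) ≡ 0
countF-false zero    = refl
countF-false (suc n) = countF-false n

countF-true : ∀ n → countF {n} (λ _ → true) ≡ n
countF-true zero    = refl
countF-true (suc n) = cong suc (countF-true n)

prodSign-false : ∀ n (t : Fin n → Sign) → prodSign (λ _ → false) t ≡ pos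
prodSign-false zero    t = refl
prodSign-false (suc n) t = prodSign-false n (t ∘ suc)

·s-identityʳ : ∀ t → t ·s pos ≡ t
·s-identityʳ pos = refl
·s-identityʳ neg = refl

module _ {m : ℕ} (s : Fin m → Sign) where

  private
    M : ℚ
    M = ℕ→ℚ m

    σ : Fin m → ℚ
    σ = Sign→ℚ ∘ s

  record StarPattern (p ε δ : ℚ) (N : Matrix (suc m)) : Set where
    field
      centre    : N zero zero ≡ p
      row₀      : ∀ k → N zero (suc k) ≡ ε * σ k
      column₀   : ∀ i → N (suc i) zero ≡ ε * σ i
      leafBlock : ∀ i k → N (suc i) (suc k) ≡ δ * Id i k

  starVec : ℚ → ℚ → Vector (suc m)
  starVec a b zero    = a
  starVec a b (suc j) = σ j * b

  starVec-cong : ∀ {a a′ b b′} → a ≡ a′ → b ≡ b′ → ∀ i → starVec a b i ≡ starVec a′ b′ i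
  starVec-cong refl refl i = refl

  starVec-zero : ∀ i → starVec 0ℚ 0ℚ i ≡ 0ℚ
  starVec-zero zero    = refl
  starVec-zero (suc j) = *-zeroʳ (σ j)

  starPattern-*ᵥ : ∀ {p ε δ N} → StarPattern p ε δ N → ∀ a b i →
    (N *ᵥ starVec a b) i ≡ starVec (p * a + M * (ε * b)) (ε * a + δ * b) i
  starPattern-*ᵥ {ε = ε} {N = N} P a b zero = cong₂ _+_ (cong (_* a) centre) (begin
    ΣF (λ k → N zero (suc k) * (σ k * b))   ≡⟨ ΣF-cong (λ k → cong (_* (σ k * b)) (row₀ k)) ⟩
    ΣF (λ k → ε * σ k * (σ k * b))          ≡⟨ ΣF-cong (λ k → spoke ε (σ k) b) ⟩
    ΣF (λ k → σ k * (σ k * (ε * b)))        ≡⟨ ΣF-cong (λ k → Sign→ℚ-involutive (s k) (ε * b)) ⟩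
    ΣF {m} (λ _ → ε * b)                    ≡⟨ ΣF-const m (ε * b) ⟩
    M * (ε * b)                             ∎)
    where
    open StarPattern P
    open ≡-Reasoning
    spoke : ∀ ε x b → ε * x * (x * b) ≡ x * (x * (ε * b))
    spoke = solve-∀ ℚ-ring
  starPattern-*ᵥ {ε = ε} {δ} {N} P a b (suc i) = begin
    N (suc i) zero * a + ΣF (λ k → N (suc i) (suc k) * (σ k * b))
      ≡⟨ cong₂ _+_ (cong (_* a) (column₀ i))
                   (ΣF-cong (λ k → trans (cong (_* (σ k * b)) (leafBlock i k)) (*-assoc δ (Id i k) (σ k * b)))) ⟩
    ε * σ i * a + ΣF (λ k → δ * (Id i k * (σ k * b)))
      ≡⟨ cong (λ t → ε * σ i * a + t) (sym (*-distribˡ-ΣF δ (λ k → Id i k * (σ k * b)))) ⟩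
    ε * σ i * a + δ * (Id *ᵥ (λ k → σ k * b)) i
      ≡⟨ cong (λ t → ε * σ i * a + δ * t) (Id-*ᵥ (λ k → σ k * b) i) ⟩
    ε * σ i * a + δ * (σ i * b)
      ≡⟨ factor ε (σ i) a δ b ⟩
    σ i * (ε * a + δ * b)
      ∎
    where
    open StarPattern P
    open ≡-Reasoning
    factor : ∀ ε x a δ b → ε * x * a + δ * (x * b) ≡ x * (ε * a + δ * b)
    factor = solve-∀ ℚ-ring

  starPattern-determinant≢0 : ∀ {p ε δ N B} → StarPattern p ε δ N → IsLeftInverse N B →
    ε ≢ 0ℚ → Fin m → p * δ - M * (ε * ε) ≢ 0ℚ
  starPattern-determinant≢0 {p} {ε} {δ} {N} {B} P B⊗N≡Id ε≢0 j det≡0 = ε≢0 (begin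
    ε                ≡⟨ Sign→ℚ-involutive (s j) ε ⟨
    σ j * (σ j * ε)  ≡⟨ cong (σ j *_) (leftInverse-kernel {N = N} {B} B⊗N≡Id v Nv≡0 (suc j)) ⟩
    σ j * 0ℚ         ≡⟨ *-zeroʳ (σ j) ⟩
    0ℚ               ∎)
    where
    open ≡-Reasoning
    v : Vector (suc m)
    v = starVec (- δ) ε
    centre-entry : ∀ p δ M ε → p * - δ + M * (ε * ε) ≡ - (p * δ - M * (ε * ε))
    centre-entry = solve-∀ ℚ-ring
    leaf-entry : ∀ ε δ → ε * - δ + δ * ε ≡ 0ℚ
    leaf-entry = solve-∀ ℚ-ring
    Nv≡0 : ∀ i → (N *ᵥ v) i ≡ 0ℚ
    Nv≡0 i = begin
      (N *ᵥ v) i                                            ≡⟨ starPattern-*ᵥ P (- δ) ε i ⟩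
      starVec (p * - δ + M * (ε * ε)) (ε * - δ + δ * ε) i   ≡⟨ starVec-cong (trans (centre-entry p δ M ε) (cong -_ det≡0))
                                                                           (leaf-entry ε δ) i ⟩
      starVec 0ℚ 0ℚ i                                       ≡⟨ starVec-zero i ⟩
      0ℚ                                                    ∎

  starPattern-coronalValue : ∀ {p ε δ N B} → StarPattern p ε δ N → IsLeftInverse N B →
    (μ : Fin (suc m) → Sign) → (∀ j → μ (suc j) ≡ s j) →
    coronalValue μ B * (p * δ - M * (ε * ε)) ≡ δ + M * p - ℕ→ℚ 2 * M * ε * Sign→ℚ (μ zero)
  starPattern-coronalValue {p} {ε} {δ} {N} {B} P B⊗N≡Id μ μ-leaf = begin
    coronalValue μ B * c                     ≡⟨ leftInverse-coronalValue {N = N} {B} B⊗N≡Id μ c y Ny≡cμ ⟩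
    e * a + ΣF (λ j → μ̂ (suc j) * (σ j * b))  ≡⟨ cong (λ t → e * a + t) (ΣF-cong leaf-term) ⟩
    e * a + ΣF {m} (λ _ → b)                 ≡⟨ cong (λ t → e * a + t) (ΣF-const m b) ⟩
    e * a + M * b                            ≡⟨ expand e δ M ε p ⟩
    e * e * δ + M * p - ℕ→ℚ 2 * M * ε * e    ≡⟨ cong (λ t → t * δ + M * p - ℕ→ℚ 2 * M * ε * e) (Sign→ℚ-square (μ zero)) ⟩
    1ℚ * δ + M * p - ℕ→ℚ 2 * M * ε * e       ≡⟨ cong (λ t → t + M * p - ℕ→ℚ 2 * M * ε * e) (*-identityˡ δ) ⟩
    δ + M * p - ℕ→ℚ 2 * M * ε * e            ∎
    where
    open ≡-Reasoning
    μ̂ : Vector (suc m)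
    μ̂ = Sign→ℚ ∘ μ
    e c a b : ℚ
    e = μ̂ zero
    c = p * δ - M * (ε * ε)
    -- Cramer's rule for the 2 × 2 system p a + m ε b = c e, ε a + δ b = c.
    a = δ * e - M * ε
    b = p - ε * e
    y : Vector (suc m)
    y = starVec a b
    centre-entry : ∀ p δ M ε e → p * (δ * e - M * ε) + M * (ε * (p - ε * e)) ≡ (p * δ - M * (ε * ε)) * e
    centre-entry = solve-∀ ℚ-ring
    leaf-entry : ∀ p δ M ε e x → x * (ε * (δ * e - M * ε) + δ * (p - ε * e)) ≡ (p * δ - M * (ε * ε)) * x
    leaf-entry = solve-∀ ℚ-ring
    expand : ∀ e δ M ε p → e * (δ * e - M * ε) + M * (p - ε * e) ≡ e * e * δ + M * p - ℕ→ℚ 2 * M * ε * e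
    expand = solve-∀ ℚ-ring
    Ny≡cμ : ∀ i → (N *ᵥ y) i ≡ c * μ̂ i
    Ny≡cμ zero    = trans (starPattern-*ᵥ P a b zero) (centre-entry p δ M ε e)
    Ny≡cμ (suc i) = begin
      (N *ᵥ y) (suc i)                   ≡⟨ starPattern-*ᵥ P a b (suc i) ⟩
      σ i * (ε * a + δ * b)              ≡⟨ leaf-entry p δ M ε e (σ i) ⟩
      c * σ i                            ≡⟨ cong (λ t → c * Sign→ℚ t) (μ-leaf i) ⟨
      c * μ̂ (suc i)                      ∎
    leaf-term : ∀ j → μ̂ (suc j) * (σ j * b) ≡ b
    leaf-term j = trans (cong (λ t → Sign→ℚ t * (σ j * b)) (μ-leaf j)) (Sign→ℚ-involutive (s j) b)

  private
    *-distribʳ-- : ∀ a b x → a * x - b * x ≡ (a - b) * x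
    *-distribʳ-- = solve-∀ ℚ-ring

    shift-spoke : ∀ X ε x → X * 0ℚ - ε * x ≡ - ε * x
    shift-spoke = solve-∀ ℚ-ring

  starPattern-≡ : ∀ {p ε δ p′ ε′ δ′ N} → p ≡ p′ → ε ≡ ε′ → δ ≡ δ′ →
    StarPattern p ε δ N → StarPattern p′ ε′ δ′ N
  starPattern-≡ refl refl refl P = P

  starPattern-+ : ∀ {p ε δ N p′ ε′ δ′ N′} → StarPattern p ε δ N → StarPattern p′ ε′ δ′ N′ →
    StarPattern (p + p′) (ε + ε′) (δ + δ′) (λ i j → N i j + N′ i j)
  starPattern-+ {ε = ε} {δ} {ε′ = ε′} {δ′} P P′ = record
    { centre    = cong₂ _+_ P.centre P′.centre
    ; row₀      = λ k → trans (cong₂ _+_ (P.row₀ k) (P′.row₀ k)) (sym (*-distribʳ-+ (σ k) ε ε′))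
    ; column₀   = λ i → trans (cong₂ _+_ (P.column₀ i) (P′.column₀ i)) (sym (*-distribʳ-+ (σ i) ε ε′))
    ; leafBlock = λ i k → trans (cong₂ _+_ (P.leafBlock i k) (P′.leafBlock i k)) (sym (*-distribʳ-+ (Id i k) δ δ′))
    }
    where
    module P = StarPattern P
    module P′ = StarPattern P′

  starPattern-- : ∀ {p ε δ N p′ ε′ δ′ N′} → StarPattern p ε δ N → StarPattern p′ ε′ δ′ N′ →
    StarPattern (p - p′) (ε - ε′) (δ - δ′) (λ i j → N i j - N′ i j)
  starPattern-- {ε = ε} {δ} {ε′ = ε′} {δ′} P P′ = record
    { centre    = cong₂ _-_ P.centre P′.centre
    ; row₀      = λ k → trans (cong₂ _-_ (P.row₀ k) (P′.row₀ k)) (*-distribʳ-- ε ε′ (σ k))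
    ; column₀   = λ i → trans (cong₂ _-_ (P.column₀ i) (P′.column₀ i)) (*-distribʳ-- ε ε′ (σ i))
    ; leafBlock = λ i k → trans (cong₂ _-_ (P.leafBlock i k) (P′.leafBlock i k)) (*-distribʳ-- δ δ′ (Id i k))
    }
    where
    module P = StarPattern P
    module P′ = StarPattern P′

  starPattern-shift : ∀ X {p ε δ N} → StarPattern p ε δ N → StarPattern (X - p) (- ε) (X - δ) (shift X N)
  starPattern-shift X {ε = ε} {δ} P = record
    { centre    = cong₂ _-_ (*-identityʳ X) centre
    ; row₀      = λ k → trans (cong (λ t → X * 0ℚ - t) (row₀ k)) (shift-spoke X ε (σ k))
    ; column₀   = λ i → trans (cong (λ t → X * 0ℚ - t) (column₀ i)) (shift-spoke X ε (σ i))
    ; leafBlock = λ i k → trans (cong₂ (λ x y → X * x - y) (Id-suc i k) (leafBlock i k)) (*-distribʳ-- X δ (Id i k))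
    }
    where open StarPattern P

  Id-starPattern : StarPattern 1ℚ 0ℚ 1ℚ Id
  Id-starPattern = record
    { centre    = refl
    ; row₀      = λ k → sym (*-zeroˡ (σ k))
    ; column₀   = λ i → sym (*-zeroˡ (σ i))
    ; leafBlock = λ i k → trans (Id-suc i k) (sym (*-identityˡ (Id i k)))
    }

  Adj-starPattern : StarPattern 0ℚ 1ℚ 0ℚ (Adj (star m s))
  Adj-starPattern = record
    { centre    = refl
    ; row₀      = λ k → sym (*-identityˡ (σ k))
    ; column₀   = λ i → sym (*-identityˡ (σ i))
    ; leafBlock = λ i k → sym (*-zeroˡ (Id i k))
    }

  Deg-starPattern : StarPattern M 0ℚ 1ℚ (Deg (star m s))
  Deg-starPattern = record
    { centre    = cong ℕ→ℚ (countF-true m)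
    ; row₀      = λ k → sym (*-zeroˡ (σ k))
    ; column₀   = λ i → sym (*-zeroˡ (σ i))
    ; leafBlock = λ i k → trans (cong (λ d → if ⌊ suc i ≟ᶠ suc k ⌋ then ℕ→ℚ (suc d) else 0ℚ) (countF-false m))
                                (StarPattern.leafBlock Id-starPattern i k)
    }

  shift-Adj-starPattern : ∀ X → StarPattern X (- 1ℚ) X (shift X (Adj (star m s)))
  shift-Adj-starPattern X =
    starPattern-≡ (+-identityʳ X) refl (+-identityʳ X) (starPattern-shift X Adj-starPattern)

  shift-Lap-starPattern : ∀ X → StarPattern (X - M) 1ℚ (X - 1ℚ) (shift X (Lap (star m s)))
  shift-Lap-starPattern X =
    starPattern-≡ (cong (λ t → X - t) (+-identityʳ M)) refl refl
      (starPattern-shift X (starPattern-- Deg-starPattern Adj-starPattern))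

  shift-SLap-starPattern : ∀ X → StarPattern (X - M) (- 1ℚ) (X - 1ℚ) (shift X (SLap (star m s)))
  shift-SLap-starPattern X =
    starPattern-≡ (cong (λ t → X - t) (+-identityʳ M)) refl refl
      (starPattern-shift X (starPattern-+ Deg-starPattern Adj-starPattern))

  star-leaf-marking : ∀ k j → markingOf k (star m s) (suc j) ≡ s j
  star-leaf-marking canonical j = trans (cong (s j ·s_) (prodSign-false m _)) (·s-identityʳ (s j))
  star-leaf-marking plurality j rewrite countF-false m with s j
  ... | pos = refl
  ... | neg = refl

lemma2p9 : (m : ℕ) → 1 ≤ m → (s : Fin m → Sign) → (k : MarkingKind) →
  let Γ = star m s
      μ = markingOf k Γ
      M = ℕ→ℚ m
      μ₁ = Sign→ℚ (μ zero)
      two = ℕ→ℚ 2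
  in
  -- (i) Σ_A(X) = ((m+1)X + 2mμ(v₁)) / (X² - m)
  (∀ (X : ℚ) (B : Matrix (suc m)) → IsInverse (shift X (Adj Γ)) B →
    (X * X - M ≢ 0ℚ) ×
    (coronalValue μ B * (X * X - M) ≡ ℕ→ℚ (suc m) * X + two * M * μ₁))
  ×
  -- (ii) Σ_L(X) = ((m+1)X - (m²+1) - 2mμ(v₁)) / (X(X - (m+1)))
  (∀ (X : ℚ) (B : Matrix (suc m)) → IsInverse (shift X (Lap Γ)) B →
    (X * (X - ℕ→ℚ (suc m)) ≢ 0ℚ) ×
    (coronalValue μ B * (X * (X - ℕ→ℚ (suc m)))
      ≡ ℕ→ℚ (suc m) * X - (M * M + ℕ→ℚ 1) - two * M * μ₁))
  ×
  -- (iii) Σ_Q(X) = ((m+1)X - (m²+1) + 2mμ(v₁)) / (X(X - m - 1))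
  (∀ (X : ℚ) (B : Matrix (suc m)) → IsInverse (shift X (SLap Γ)) B →
    (X * (X - M - ℕ→ℚ 1) ≢ 0ℚ) ×
    (coronalValue μ B * (X * (X - M - ℕ→ℚ 1))
      ≡ ℕ→ℚ (suc m) * X - (M * M + ℕ→ℚ 1) + two * M * μ₁))
lemma2p9 m 1≤m s k rewrite ℕ→ℚ-suc m =
    (λ X B inv → coronal {B = B} (shift-Adj-starPattern s X) inv (λ ()) (adjacency-det X M) (adjacency-num X M e))
  , (λ X B inv → coronal {B = B} (shift-Lap-starPattern s X) inv (λ ()) (laplacian-det X M) (laplacian-num X M e))
  , (λ X B inv → coronal {B = B} (shift-SLap-starPattern s X) inv (λ ()) (signless-det X M) (signless-num X M e))
  where
  M = ℕ→ℚ m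
  μ = markingOf k (star m s)
  e = Sign→ℚ (μ zero)

  coronal : ∀ {p ε δ c r} {N B : Matrix (suc m)} → StarPattern s p ε δ N → IsInverse N B → ε ≢ 0ℚ →
    p * δ - M * (ε * ε) ≡ c → δ + M * p - ℕ→ℚ 2 * M * ε * e ≡ r →
    (c ≢ 0ℚ) × (coronalValue μ B * c ≡ r)
  coronal {B = B} P (_ , B⊗N≡Id) ε≢0 refl refl =
      starPattern-determinant≢0 s {B = B} P B⊗N≡Id ε≢0 (fromℕ< 1≤m)
    , starPattern-coronalValue s {B = B} P B⊗N≡Id μ (star-leaf-marking s k)

  adjacency-det : ∀ X M → X * X - M * (- 1ℚ * - 1ℚ) ≡ X * X - M
  adjacency-det = solve-∀ ℚ-ring
  adjacency-num : ∀ X M e → X + M * X - ℕ→ℚ 2 * M * - 1ℚ * e ≡ (M + 1ℚ) * X + ℕ→ℚ 2 * M * e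
  adjacency-num = solve-∀ ℚ-ring
  laplacian-det : ∀ X M → (X - M) * (X - 1ℚ) - M * (1ℚ * 1ℚ) ≡ X * (X - (M + 1ℚ))
  laplacian-det = solve-∀ ℚ-ring
  laplacian-num : ∀ X M e → X - 1ℚ + M * (X - M) - ℕ→ℚ 2 * M * 1ℚ * e
                          ≡ (M + 1ℚ) * X - (M * M + ℕ→ℚ 1) - ℕ→ℚ 2 * M * e
  laplacian-num = solve-∀ ℚ-ring
  signless-det : ∀ X M → (X - M) * (X - 1ℚ) - M * (- 1ℚ * - 1ℚ) ≡ X * (X - M - ℕ→ℚ 1)
  signless-det = solve-∀ ℚ-ring
  signless-num : ∀ X M e → X - 1ℚ + M * (X - M) - ℕ→ℚ 2 * M * - 1ℚ * e
                         ≡ (M + 1ℚ) * X - (M * M + ℕ→ℚ 1) + ℕ→ℚ 2 * M * e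
  signless-num = solve-∀ ℚ-ring
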